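{- Let $\mathbf{p}=(\mathbf{p}_1,\dots,\mathbf{p}_n)$ and $\mathbf{q}=(\mathbf{q}_1,\dots,\mathbf{q}_n)$ be point configurations in $\mathbb{R}^d$ and assume that $\mathbf{q}$ is obtained from $\mathbf{p}$ in one of the following two ways: (1) there is a global linear transformation $l:\mathbb{R}^d\to\mathbb{R}^d$ with $l(\mathbf{p}_i)=\mathbf{q}_i$ for all $i$; or (2) there are nonzero scalars $\alpha_1,\dots,\alpha_n$ with $\mathbf{q}_i=\alpha_i\mathbf{p}_i$ for each $i$. Then $\mathcal{H}_d(\mathbf{p})=\mathcal{H}_d(\mathbf{q})$.
   Context: A point configuration is a finite list of distinct points in $\mathbb{R}^d$. For $\mathbf{p}=(\mathbf{p}_1,\dots,\mathbf{p}_n)$, the hyperconnectivity matrix $H(\mathbf{p})$ has rows indexed by pairs $\{i,j\}\in\binom{[n]}{2}$ ($i<j$) and $nd$ columns grouped into $n$ blocks of size $d$; row $\{i,j\}$ has $\mathbf{p}_j$ in block $i$, $-\mathbf{p}_i$ in block $j$, and zeros elsewhere. The hyperconnectivity matroid $\mathcal{H}_d(\mathbf{p})$ is the linear matroid of the rows of $H(\mathbf{p})$, on ground set $\binom{[n]}{2}$. -}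

module Defs where

open import Level using (Level; _⊔_) renaming (suc to lsuc)
open import Data.Nat using (ℕ; zero; suc)
open import Data.List.Relation.Unary.Unique.Propositional using (Unique)
open import Data.Fin using (Fin; zero; suc; _<_; _≟_)
open import Data.Product using (Σ; ∃; _×_; _,_)
open import Data.List using (List; []; _∷_)
open import Data.List.Membership.Propositional using (_∈_)
open import Relation.Nullary using (¬_; yes; no)
open import Relation.Binary.PropositionalEquality using (_≡_; _≢_)
open import Algebra.Bundles using (CommutativeRing)

record Field (c ℓ : Level) : Set (lsuc (c ⊔ ℓ)) where
  field
    commutativeRing : CommutativeRing c ℓ
  open CommutativeRing commutativeRing public
  field
    0≉1     : ¬ (0# ≈ 1#)
    inverse : ∀ x → ¬ (x ≈ 0#) → Σ Carrier (λ y → (x * y) ≈ 1#)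

module _ {c ℓ : Level} (F : Field c ℓ) where
  open Field F using (Carrier; _≈_; 0#; 1#; _+_; _*_; -_)

  Σ[<_] : (m : ℕ) → (Fin m → Carrier) → Carrier
  Σ[< zero ] f = 0#
  Σ[< suc m ] f = f zero + Σ[< m ] (λ i → f (suc i))

  Point : ℕ → Set c
  Point d = Fin d → Carrier

  _≈ᵖ_ : {d : ℕ} → Point d → Point d → Set ℓ
  x ≈ᵖ y = ∀ k → x k ≈ y k

  Distinct : {n d : ℕ} → (Fin n → Point d) → Set ℓ
  Distinct {n} p = (i j : Fin n) → i ≢ j → ¬ (p i ≈ᵖ p j)

  Matrix : ℕ → Set c
  Matrix d = Fin d → Fin d → Carrier

  apply : {d : ℕ} → Matrix d → Point d → Point d
  apply {d} L x k = Σ[< d ] (λ m → L k m * x m)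

  _·ᴹ_ : {d : ℕ} → Matrix d → Matrix d → Matrix d
  _·ᴹ_ {d} A B i j = Σ[< d ] (λ m → A i m * B m j)

  identity : {d : ℕ} → Matrix d
  identity i j with i ≟ j
  ... | yes _ = 1#
  ... | no  _ = 0#

  _≈ᴹ_ : {d : ℕ} → Matrix d → Matrix d → Set ℓ
  A ≈ᴹ B = ∀ i j → A i j ≈ B i j

  Invertible : {d : ℕ} → Matrix d → Set (c ⊔ ℓ)
  Invertible {d} L = Σ (Matrix d) (λ M → ((M ·ᴹ L) ≈ᴹ identity) × ((L ·ᴹ M) ≈ᴹ identity))

  Edge : ℕ → Set
  Edge n = Σ (Fin n × Fin n) (λ { (i , j) → i < j })

  -- the row of the hyperconnectivity matrix H(p) indexed by {i,j}:
  -- block i contains p_j, block j contains -p_i, all other blocks are zero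
  -- (a vector of length nd, organised as n blocks of size d)
  hrow : {n d : ℕ} → (Fin n → Point d) → Edge n → Fin n → Fin d → Carrier
  hrow p ((i , j) , _) v k with v ≟ i | v ≟ j
  ... | yes _ | _     = p j k
  ... | no _  | yes _ = - (p i k)
  ... | no _  | no _  = 0#

  combo : {n d : ℕ} → (Fin n → Point d) → (Edge n → Carrier) → List (Edge n) → Fin n → Fin d → Carrier
  combo p c [] v k = 0#
  combo p c (e ∷ S) v k = (c e * hrow p e v k) + combo p c S v k

  Independent : {n d : ℕ} → (Fin n → Point d) → List (Edge n) → Set (c ⊔ ℓ)
  Independent p S = (c : Edge _ → Carrier) →
    (∀ v k → combo p c S v k ≈ 0#) → ∀ e → e ∈ S → c e ≈ 0#

  SameHypMatroid : {n d : ℕ} → (Fin n → Point d) → (Fin n → Point d) → Set (c ⊔ ℓ)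
  SameHypMatroid {n} p q = (S : List (Edge n)) → Unique S →
    (Independent p S → Independent q S) × (Independent q S → Independent p S)

-- Both transformations act on the rows of H(p) block by block: diag(L,…,L)
-- carries the row {i,j} of H(p) to the row {i,j} of H(q), and diag(α₁,…,αₙ)
-- carries the row {i,j} of H(q) to αᵢαⱼ times the row {i,j} of H(p).  A
-- block-diagonal linear map sending each row of one matrix to a nonzero
-- multiple of the matching row of the other sends a vanishing combination of
-- rows of the first to a vanishing combination of rows of the second, with
-- coefficients rescaled by those nonzero multiples; so independence transfers.
-- Using L and L⁻¹, and α and α⁻¹, gives both inclusions.
module Submission where

open import Defs
open import Level using (Level)
open import Data.Nat using (ℕ; zero; suc)
open import Data.Fin using (Fin; zero; suc; _≟_)
open import Data.Fin.Properties using (suc-injective)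
open import Data.List using ([]; _∷_)
open import Data.Product using (Σ; _×_; _,_; proj₁; proj₂)
open import Data.Sum using (_⊎_; inj₁; inj₂)
open import Relation.Nullary using (¬_; yes; no; contradiction)
open import Relation.Binary.PropositionalEquality
  using (_≡_; _≢_; refl; cong)
import Algebra.Properties.CommutativeSemigroup as CommutativeSemigroupProperties
import Algebra.Properties.Ring as RingProperties
import Algebra.Properties.Semiring.Sum as SemiringSum
import Relation.Binary.Reasoning.Setoid as SetoidReasoning

module _ {c ℓ : Level} (F : Field c ℓ) where
  open Field F hiding (zero; refl)
  open Field F using () renaming (refl to ≈-refl)
  open RingProperties ring using (-1*x≈-x; -‿distribʳ-*)
  open SemiringSum semiring
    using (sum; sum-cong-≋; sum-replicate-zero; ∑-distrib-+; ∑-comm; *-distribˡ-sum; *-distribʳ-sum)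
  open CommutativeSemigroupProperties *-commutativeSemigroup using (x∙yz≈y∙xz; x∙yz≈yx∙z; xy∙z≈y∙xz)
  open SetoidReasoning setoid

  Σ[<]≡sum : ∀ m (f : Fin m → Carrier) → Σ[<_] F m f ≡ sum f
  Σ[<]≡sum zero    f = refl
  Σ[<]≡sum (suc m) f = cong (f zero +_) (Σ[<]≡sum m (λ i → f (suc i)))

  sum-zero : ∀ {m} {f : Fin m → Carrier} → (∀ i → f i ≈ 0#) → sum f ≈ 0#
  sum-zero {m} f≈0 = trans (sum-cong-≋ f≈0) (sum-replicate-zero m)

  sum-neg : ∀ {m} (f : Fin m → Carrier) → sum (λ i → - f i) ≈ - sum f
  sum-neg f = begin
    sum (λ i → - f i)      ≈⟨ sum-cong-≋ (λ i → sym (-1*x≈-x (f i))) ⟩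
    sum (λ i → - 1# * f i) ≈⟨ *-distribˡ-sum (- 1#) f ⟨
    - 1# * sum f           ≈⟨ -1*x≈-x (sum f) ⟩
    - sum f                ∎

  sum-single : ∀ {m} (k : Fin m) (f : Fin m → Carrier) →
               (∀ j → j ≢ k → f j ≈ 0#) → sum f ≈ f k
  sum-single {suc m} zero    f f≈0 =
    trans (+-congˡ (sum-zero (λ j → f≈0 (suc j) λ ()))) (+-identityʳ (f zero))
  sum-single {suc m} (suc k) f f≈0 =
    trans (+-cong (f≈0 zero λ ()) (sum-single k (λ i → f (suc i)) f∘suc≈0))
          (+-identityˡ (f (suc k)))
    where
    f∘suc≈0 : ∀ j → j ≢ k → f (suc j) ≈ 0#
    f∘suc≈0 j j≢k = f≈0 (suc j) (λ sj≡sk → j≢k (suc-injective sj≡sk))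

  1≉0 : ¬ (1# ≈ 0#)
  1≉0 1≈0 = 0≉1 (sym 1≈0)

  x*y≈0⇒y≈0 : ∀ {x y} → ¬ (x ≈ 0#) → x * y ≈ 0# → y ≈ 0#
  x*y≈0⇒y≈0 {x} {y} x≉0 xy≈0 with inverse x x≉0
  ... | x⁻¹ , xx⁻¹≈1 = begin
    y             ≈⟨ *-identityˡ y ⟨
    1# * y        ≈⟨ *-congʳ xx⁻¹≈1 ⟨
    x * x⁻¹ * y   ≈⟨ xy∙z≈y∙xz x x⁻¹ y ⟩
    x⁻¹ * (x * y) ≈⟨ *-congˡ xy≈0 ⟩
    x⁻¹ * 0#      ≈⟨ zeroʳ x⁻¹ ⟩
    0#            ∎

  x*y≉0 : ∀ {x y} → ¬ (x ≈ 0#) → ¬ (y ≈ 0#) → ¬ (x * y ≈ 0#)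
  x*y≉0 x≉0 y≉0 xy≈0 = y≉0 (x*y≈0⇒y≈0 x≉0 xy≈0)

  x*y≈1⇒y≉0 : ∀ {x y} → x * y ≈ 1# → ¬ (y ≈ 0#)
  x*y≈1⇒y≉0 {x} xy≈1 y≈0 = 0≉1 (trans (sym (zeroʳ x)) (trans (*-congˡ (sym y≈0)) xy≈1))

  apply≡sum : ∀ {d} (L : Matrix F d) (x : Point F d) k →
              apply F L x k ≡ sum (λ m → L k m * x m)
  apply≡sum {d} L x k = Σ[<]≡sum d (λ m → L k m * x m)

  apply-congʳ : ∀ {d} (L : Matrix F d) {x y : Point F d} →
                (∀ k → x k ≈ y k) → ∀ k → apply F L x k ≈ apply F L y k
  apply-congʳ L {x} {y} x≈y k
    rewrite apply≡sum L x k | apply≡sum L y k = sum-cong-≋ (λ m → *-congˡ (x≈y m))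

  apply-zero : ∀ {d} (L : Matrix F d) {x : Point F d} →
               (∀ k → x k ≈ 0#) → ∀ k → apply F L x k ≈ 0#
  apply-zero L {x} x≈0 k rewrite apply≡sum L x k =
    sum-zero (λ m → trans (*-congˡ (x≈0 m)) (zeroʳ (L k m)))

  apply-neg : ∀ {d} (L : Matrix F d) (x : Point F d) k →
              apply F L (λ m → - x m) k ≈ - apply F L x k
  apply-neg L x k rewrite apply≡sum L (λ m → - x m) k | apply≡sum L x k = begin
    sum (λ m → L k m * - x m)   ≈⟨ sum-cong-≋ (λ m → sym (-‿distribʳ-* (L k m) (x m))) ⟩
    sum (λ m → - (L k m * x m)) ≈⟨ sum-neg (λ m → L k m * x m) ⟩
    - sum (λ m → L k m * x m)   ∎

  apply-*-+ : ∀ {d} (L : Matrix F d) a (x y : Point F d) k →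
              apply F L (λ m → a * x m + y m) k ≈ a * apply F L x k + apply F L y k
  apply-*-+ L a x y k
    rewrite apply≡sum L (λ m → a * x m + y m) k | apply≡sum L x k | apply≡sum L y k = begin
    sum (λ m → L k m * (a * x m + y m))
      ≈⟨ sum-cong-≋ (λ m → distribˡ (L k m) (a * x m) (y m)) ⟩
    sum (λ m → L k m * (a * x m) + L k m * y m)
      ≈⟨ ∑-distrib-+ (λ m → L k m * (a * x m)) (λ m → L k m * y m) ⟩
    sum (λ m → L k m * (a * x m)) + sum (λ m → L k m * y m)
      ≈⟨ +-congʳ (sum-cong-≋ (λ m → x∙yz≈y∙xz (L k m) a (x m))) ⟩
    sum (λ m → a * (L k m * x m)) + sum (λ m → L k m * y m)
      ≈⟨ +-congʳ (*-distribˡ-sum a (λ m → L k m * x m)) ⟨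
    a * sum (λ m → L k m * x m) + sum (λ m → L k m * y m) ∎

  identity-diagonal : ∀ {d} (k : Fin d) x → identity F k k * x ≈ x
  identity-diagonal k x with k ≟ k
  ... | yes _   = *-identityˡ x
  ... | no  k≢k = contradiction refl k≢k

  identity-offDiagonal : ∀ {d} (k j : Fin d) x → j ≢ k → identity F k j * x ≈ 0#
  identity-offDiagonal k j x j≢k with k ≟ j
  ... | yes refl = contradiction refl j≢k
  ... | no  _    = zeroˡ x

  apply-identity : ∀ {d} (x : Point F d) k → apply F (identity F) x k ≈ x k
  apply-identity x k rewrite apply≡sum (identity F) x k = begin
    sum (λ m → identity F k m * x m)
      ≈⟨ sum-single k _ (λ j j≢k → identity-offDiagonal k j (x j) j≢k) ⟩
    identity F k k * x k
      ≈⟨ identity-diagonal k (x k) ⟩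
    x k ∎

  apply-congˡ : ∀ {d} {A B : Matrix F d} → _≈ᴹ_ F A B →
                ∀ (x : Point F d) k → apply F A x k ≈ apply F B x k
  apply-congˡ {A = A} {B} A≈B x k rewrite apply≡sum A x k | apply≡sum B x k =
    sum-cong-≋ (λ m → *-congʳ (A≈B k m))

  apply-·ᴹ : ∀ {d} (A B : Matrix F d) (x : Point F d) k →
             apply F A (apply F B x) k ≈ apply F (_·ᴹ_ F A B) x k
  apply-·ᴹ {d} A B x k = begin
    apply F A (apply F B x) k
      ≡⟨ apply≡sum A (apply F B x) k ⟩
    sum (λ m → A k m * apply F B x m)
      ≈⟨ sum-cong-≋ (λ m → *-congˡ (reflexive (apply≡sum B x m))) ⟩
    sum (λ m → A k m * sum (λ l → B m l * x l))
      ≈⟨ sum-cong-≋ (λ m → *-distribˡ-sum (A k m) (λ l → B m l * x l)) ⟩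
    sum (λ m → sum (λ l → A k m * (B m l * x l)))
      ≈⟨ ∑-comm (λ m l → A k m * (B m l * x l)) ⟩
    sum (λ l → sum (λ m → A k m * (B m l * x l)))
      ≈⟨ sum-cong-≋ (λ l → sum-cong-≋ (λ m → *-assoc (A k m) (B m l) (x l))) ⟨
    sum (λ l → sum (λ m → A k m * B m l * x l))
      ≈⟨ sum-cong-≋ (λ l → *-distribʳ-sum (x l) (λ m → A k m * B m l)) ⟨
    sum (λ l → sum (λ m → A k m * B m l) * x l)
      ≈⟨ sum-cong-≋ (λ l → *-congʳ (reflexive (Σ[<]≡sum d (λ m → A k m * B m l)))) ⟨
    sum (λ l → _·ᴹ_ F A B k l * x l)
      ≡⟨ apply≡sum (_·ᴹ_ F A B) x k ⟨
    apply F (_·ᴹ_ F A B) x k ∎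

  apply-leftInverse : ∀ {d} {M L : Matrix F d} → _≈ᴹ_ F (_·ᴹ_ F M L) (identity F) →
                      ∀ {x y : Point F d} → (∀ k → apply F L x k ≈ y k) →
                      ∀ k → apply F M y k ≈ x k
  apply-leftInverse {M = M} {L} ML≈I {x} {y} Lx≈y k = begin
    apply F M y k                  ≈⟨ apply-congʳ M Lx≈y k ⟨
    apply F M (apply F L x) k      ≈⟨ apply-·ᴹ M L x k ⟩
    apply F (_·ᴹ_ F M L) x k       ≈⟨ apply-congˡ ML≈I x k ⟩
    apply F (identity F) x k       ≈⟨ apply-identity x k ⟩
    x k                            ∎

  scalarMatrix : ∀ {d} → Carrier → Matrix F d
  scalarMatrix a i j = a * identity F i j

  apply-scalarMatrix : ∀ {d} a (x : Point F d) k → apply F (scalarMatrix a) x k ≈ a * x k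
  apply-scalarMatrix a x k = begin
    apply F (scalarMatrix a) x k           ≡⟨ apply≡sum (scalarMatrix a) x k ⟩
    sum (λ m → a * identity F k m * x m)   ≈⟨ sum-cong-≋ (λ m → *-assoc a (identity F k m) (x m)) ⟩
    sum (λ m → a * (identity F k m * x m)) ≈⟨ *-distribˡ-sum a (λ m → identity F k m * x m) ⟨
    a * sum (λ m → identity F k m * x m)   ≡⟨ cong (a *_) (apply≡sum (identity F) x k) ⟨
    a * apply F (identity F) x k           ≈⟨ *-congˡ (apply-identity x k) ⟩
    a * x k                                ∎

  module _ {n d : ℕ} (p q : Fin n → Point F d) where

    combo-transfer : (A : Fin n → Matrix F d) (w : Edge F n → Carrier) →
      (∀ e v k → apply F (A v) (hrow F p e v) k ≈ w e * hrow F q e v k) →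
      ∀ (a : Edge F n → Carrier) S v k →
      apply F (A v) (combo F p a S v) k ≈ combo F q (λ e → w e * a e) S v k
    combo-transfer A w rows a []      v k = apply-zero (A v) (λ _ → ≈-refl) k
    combo-transfer A w rows a (e ∷ S) v k = begin
      apply F (A v) (combo F p a (e ∷ S) v) k
        ≈⟨ apply-*-+ (A v) (a e) (hrow F p e v) (combo F p a S v) k ⟩
      a e * apply F (A v) (hrow F p e v) k + apply F (A v) (combo F p a S v) k
        ≈⟨ +-cong (*-congˡ (rows e v k)) (combo-transfer A w rows a S v k) ⟩
      a e * (w e * hrow F q e v k) + combo F q (λ e → w e * a e) S v k
        ≈⟨ +-congʳ (x∙yz≈yx∙z (a e) (w e) (hrow F q e v k)) ⟩
      combo F q (λ e → w e * a e) (e ∷ S) v k ∎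

    independent-transfer : (A : Fin n → Matrix F d) (w : Edge F n → Carrier) →
      (∀ e → ¬ (w e ≈ 0#)) →
      (∀ e v k → apply F (A v) (hrow F p e v) k ≈ w e * hrow F q e v k) →
      ∀ S → Independent F q S → Independent F p S
    independent-transfer A w w≉0 rows S q-independent a p-combo≈0 e e∈S =
      x*y≈0⇒y≈0 (w≉0 e) (q-independent (λ e → w e * a e) q-combo≈0 e e∈S)
      where
      q-combo≈0 : ∀ v k → combo F q (λ e → w e * a e) S v k ≈ 0#
      q-combo≈0 v k =
        trans (sym (combo-transfer A w rows a S v k)) (apply-zero (A v) (p-combo≈0 v) k)

    hrow-image : (L : Matrix F d) → (∀ i k → apply F L (p i) k ≈ q i k) →
                 ∀ e v k → apply F L (hrow F p e v) k ≈ hrow F q e v k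
    hrow-image L Lp≈q ((i , j) , _) v k with v ≟ i | v ≟ j
    ... | yes _ | _     = Lp≈q j k
    ... | no _  | yes _ = trans (apply-neg L (p i) k) (-‿cong (Lp≈q i k))
    ... | no _  | no _  = apply-zero L (λ _ → ≈-refl) k

  edgeWeight : ∀ {n} → (Fin n → Carrier) → Edge F n → Carrier
  edgeWeight α ((i , j) , _) = α i * α j

  hrow-rescale : ∀ {n d} (α : Fin n → Carrier) (p q : Fin n → Point F d) →
                 (∀ i k → q i k ≈ α i * p i k) →
                 ∀ e v k → α v * hrow F q e v k ≈ edgeWeight α e * hrow F p e v k
  hrow-rescale α p q q≈αp ((i , j) , _) v k with v ≟ i | v ≟ j
  ... | yes refl | _        = trans (*-congˡ (q≈αp j k)) (sym (*-assoc (α i) (α j) (p j k)))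
  ... | no _     | yes refl = begin
    α j * - q i k           ≈⟨ *-congˡ (-‿cong (q≈αp i k)) ⟩
    α j * - (α i * p i k)   ≈⟨ *-congˡ (-‿distribʳ-* (α i) (p i k)) ⟩
    α j * (α i * - p i k)   ≈⟨ x∙yz≈yx∙z (α j) (α i) (- p i k) ⟩
    α i * α j * - p i k     ∎
  ... | no _     | no _     = trans (zeroʳ (α v)) (sym (zeroʳ (α i * α j)))

  linearImage-reflects-independence : ∀ {n d} (p q : Fin n → Point F d) (L : Matrix F d) →
    (∀ i k → apply F L (p i) k ≈ q i k) → ∀ S → Independent F q S → Independent F p S
  linearImage-reflects-independence p q L Lp≈q =
    independent-transfer p q (λ _ → L) (λ _ → 1#) (λ _ → 1≉0)
      (λ e v k → trans (hrow-image p q L Lp≈q e v k) (sym (*-identityˡ (hrow F q e v k))))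

  rescaling-preserves-independence : ∀ {n d} (α : Fin n → Carrier) (p q : Fin n → Point F d) →
    (∀ i → ¬ (α i ≈ 0#)) → (∀ i k → q i k ≈ α i * p i k) →
    ∀ S → Independent F p S → Independent F q S
  rescaling-preserves-independence α p q α≉0 q≈αp =
    independent-transfer q p (λ v → scalarMatrix (α v)) (edgeWeight α) edgeWeight≉0
      (λ e v k → trans (apply-scalarMatrix (α v) (hrow F q e v) k) (hrow-rescale α p q q≈αp e v k))
    where
    edgeWeight≉0 : ∀ e → ¬ (edgeWeight α e ≈ 0#)
    edgeWeight≉0 ((i , j) , _) = x*y≉0 (α≉0 i) (α≉0 j)

  rescaling-inverse : ∀ {n d} (α : Fin n → Carrier) (p q : Fin n → Point F d) →
    (∀ i → ¬ (α i ≈ 0#)) → (∀ i k → q i k ≈ α i * p i k) →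
    Σ (Fin n → Carrier) λ β → (∀ i → ¬ (β i ≈ 0#)) × (∀ i k → p i k ≈ β i * q i k)
  rescaling-inverse α p q α≉0 q≈αp = β , (λ i → x*y≈1⇒y≉0 (αβ≈1 i)) , p≈βq
    where
    β : _ → Carrier
    β i = proj₁ (inverse (α i) (α≉0 i))
    αβ≈1 : ∀ i → α i * β i ≈ 1#
    αβ≈1 i = proj₂ (inverse (α i) (α≉0 i))
    p≈βq : ∀ i k → p i k ≈ β i * q i k
    p≈βq i k = begin
      p i k               ≈⟨ *-identityˡ (p i k) ⟨
      1# * p i k          ≈⟨ *-congʳ (αβ≈1 i) ⟨
      α i * β i * p i k   ≈⟨ xy∙z≈y∙xz (α i) (β i) (p i k) ⟩
      β i * (α i * p i k) ≈⟨ *-congˡ (q≈αp i k) ⟨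
      β i * q i k         ∎

lemma2p1 : {c ℓ : Level} (F : Field c ℓ) (n d : ℕ) (p q : Fin n → Point F d) →
    Distinct F p → Distinct F q →
    (Σ (Matrix F d) (λ L → Invertible F L × ((i : Fin n) → _≈ᵖ_ F (apply F L (p i)) (q i))))
    ⊎ (Σ (Fin n → Field.Carrier F) (λ α → ((i : Fin n) → ¬ (Field._≈_ F (α i) (Field.0# F))) ×
         ((i : Fin n) → (k : Fin d) → Field._≈_ F (q i k) (Field._*_ F (α i) (p i k))))) →
    SameHypMatroid F p q
lemma2p1 F n d p q _ _ (inj₁ (L , (M , ML≈I , _) , Lp≈q)) S _ =
    linearImage-reflects-independence F q p M (λ i → apply-leftInverse F ML≈I (Lp≈q i)) S
  , linearImage-reflects-independence F p q L Lp≈q S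
lemma2p1 F n d p q _ _ (inj₂ (α , α≉0 , q≈αp)) S _
  with rescaling-inverse F α p q α≉0 q≈αp
... | β , β≉0 , p≈βq =
    rescaling-preserves-independence F α p q α≉0 q≈αp S
  , rescaling-preserves-independence F β q p β≉0 p≈βq S
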